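{- For all integers $k,d\geq 1$, the graph $S(k,d)$ contains no path on $2^{k+1}$ vertices and no cycle of length at least $2^k+1$.
   Context: $S(h,d)$ is defined recursively: $S(0,d)$ is the graph with one vertex and no edges; for $h\geq 1$, $S(h,d)$ is obtained from $d+1$ disjoint copies of $S(h-1,d)$ by adding one new vertex adjacent to all other vertices. Containment means as a subgraph. -}

module Defs where

open import Data.Nat using (ℕ; zero; suc; _≤_; _∸_)
open import Data.Fin using (Fin; toℕ)
open import Data.Maybe using (Maybe; just; nothing)
open import Data.Product using (Σ; _×_; _,_)
open import Data.Sum using (_⊎_)
open import Data.Unit using (⊤)
open import Data.Empty using (⊥)
open import Relation.Binary.PropositionalEquality using (_≡_)
open import Function.Definitions using (Injective)

record Graph : Set₁ where
  field
    V   : Set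
    Adj : V → V → Set
open Graph public

-- Vertices of S(h,d): S(0,d) has one vertex; the vertices of S(h+1,d) are the
-- new apex vertex (nothing) and pairs (i , x) with i a copy index among the
-- d+1 copies of S(h,d) and x a vertex of that copy.
SV : ℕ → ℕ → Set
SV zero    d = ⊤
SV (suc h) d = Maybe (Fin (suc d) × SV h d)

SAdj : (h d : ℕ) → SV h d → SV h d → Set
SAdj zero    d _ _ = ⊥
SAdj (suc h) d nothing  nothing  = ⊥
SAdj (suc h) d nothing  (just _) = ⊤
SAdj (suc h) d (just _) nothing  = ⊤
SAdj (suc h) d (just (i , x)) (just (j , y)) = (i ≡ j) × SAdj h d x y

S : ℕ → ℕ → Graph
S h d = record { V = SV h d ; Adj = SAdj h d }

ContainsPath : Graph → ℕ → Set
ContainsPath G m =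
  Σ (Fin m → V G) λ f → Injective _≡_ _≡_ f ×
    ((i j : Fin m) → toℕ j ≡ suc (toℕ i) → Adj G (f i) (f j))

ContainsCycle : Graph → ℕ → Set
ContainsCycle G m = (3 ≤ m) ×
  Σ (Fin m → V G) λ f → Injective _≡_ _≡_ f ×
    ((i j : Fin m) →
       (toℕ j ≡ suc (toℕ i)) ⊎ ((toℕ i ≡ m ∸ 1) × (toℕ j ≡ 0)) →
       Adj G (f i) (f j))

module Submission where

-- The whole argument rests on one structural fact about
-- S(h+1,d): the copies of S(h,d) are joined only through the apex, so a
-- path avoiding the apex stays inside a single copy and is a path of S(h,d).
--
--  * A path of S(h,d) has fewer than 2^(h+1) vertices: S(0,d) has no edges,
--    and a path of S(h+1,d) through the apex is the apex plus two apex-free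
--    pieces, each of fewer than 2^(h+1) vertices.
--  * A cycle of S(h+1,d) has at most 2^(h+1) vertices: if it avoids the apex
--    it is a path of one copy; otherwise deleting the apex and reading the
--    cycle from the apex's successor leaves an apex-free path.

open import Defs
open import Data.Nat using (ℕ; zero; suc; _≤_; _<_; _+_; _^_; z<s; s<s)
open import Data.Nat.Properties using (<⇒≱; <⇒≤; m≤m+n; +-comm; +-identityʳ; +-mono-≤; ≤-trans; ≤-reflexive)
open import Data.Fin as Fin using (Fin; toℕ; fromℕ)
open import Data.Fin.Properties using (toℕ-fromℕ)
open import Data.Maybe using (just; nothing)
open import Data.Maybe.Relation.Binary.Connected using (Connected; just; just-nothing; nothing-just; nothing)
open import Data.List using (List; []; _∷_; _++_; map; length; head; last; tabulate)
open import Data.List.Properties using (length-++; length-map; length-tabulate)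
open import Data.List.Relation.Unary.Any using (here; there; any?)
open import Data.List.Relation.Unary.All.Properties using (++⁻ˡ)
open import Data.List.Relation.Unary.Linked using (Linked; []; [-]; _∷_)
import Data.List.Relation.Unary.Linked as Linked
import Data.List.Relation.Unary.Linked.Properties as Linkedₚ
open import Data.List.Relation.Unary.Unique.Propositional using (Unique; []; _∷_)
import Data.List.Relation.Unary.Unique.Propositional.Properties as Uniqueₚ
open import Data.List.Membership.Propositional using (_∉_)
open import Data.List.Membership.Propositional.Properties using (∈-∃++; ∈-++⁺ˡ; ∈-++⁺ʳ)
open import Data.List.Relation.Binary.Permutation.Propositional using (_↭_; prep; ↭-trans; ↭⇒↭ₛ)
open import Data.List.Relation.Binary.Permutation.Propositional.Properties using (shift; ++-comm; ↭-length)
import Data.List.Relation.Binary.Permutation.Setoid.Properties as Permₛ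
open import Data.Product using (Σ; ∃₂; _×_; _,_; proj₁; proj₂)
open import Data.Empty using (⊥-elim)
open import Data.Sum using (inj₁; inj₂)
open import Function using (_∘_)
open import Relation.Nullary using (¬_; Dec; yes; no)
open import Relation.Binary.PropositionalEquality using (_≡_; refl; sym; trans; cong; subst; setoid)

private
  variable
    A : Set
    R : A → A → Set
    x : A
    xs ys zs : List A

IsPath : (G : Graph) → List (V G) → Set
IsPath G xs = Unique xs × Linked (Adj G) xs

IsCycle : (G : Graph) → List (V G) → Set
IsCycle G xs = IsPath G xs × Connected (Adj G) (last xs) (head xs)

linked-++⁻ : ∀ xs → Linked R (xs ++ ys) → Linked R xs × Linked R ys
linked-++⁻ []           l       = [] , l
linked-++⁻ (x ∷ [])     l       = [-] , Linked.tail l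
linked-++⁻ (x ∷ y ∷ xs) (r ∷ l) with lx , ly ← linked-++⁻ (y ∷ xs) l = r ∷ lx , ly

unique-++⁻ : ∀ xs → Unique (xs ++ ys) → Unique xs × Unique ys
unique-++⁻ []       u          = [] , u
unique-++⁻ (x ∷ xs) (x∉ ∷ u) with ux , uy ← unique-++⁻ xs u = ++⁻ˡ xs x∉ ∷ ux , uy

rotate↭ : ∀ (x : A) ys zs → ys ++ x ∷ zs ↭ x ∷ zs ++ ys
rotate↭ x ys zs = ↭-trans (shift x ys zs) (prep x (++-comm ys zs))

unique-↭ : ∀ {A : Set} {xs ys : List A} → xs ↭ ys → Unique xs → Unique ys
unique-↭ {A = A} p = Permₛ.Unique-resp-↭ (setoid A) (↭⇒↭ₛ p)

last-++ : ∀ (xs : List A) {y ys} → last (xs ++ y ∷ ys) ≡ last (y ∷ ys)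
last-++ []           = refl
last-++ (x ∷ [])     = refl
last-++ (x ∷ x′ ∷ xs) = last-++ (x′ ∷ xs)

closing-edge : ∀ ys zs → Connected R (last (ys ++ x ∷ zs)) (head (ys ++ x ∷ zs)) →
               Connected R (last zs) (head ys)
closing-edge []       zs       _ = into-nothing (last zs)
  where
  into-nothing : ∀ m → Connected R m nothing
  into-nothing (just _) = just-nothing
  into-nothing nothing  = nothing
closing-edge (y ∷ ys) []       _ = nothing-just
closing-edge {x = x} (y ∷ ys) (z ∷ zs) c
  rewrite last-++ (y ∷ ys) {x} {z ∷ zs} = c

unique-rotate : ∀ {A : Set} {x : A} ys zs → Unique (ys ++ x ∷ zs) → x ∉ zs ++ ys × Unique (zs ++ ys)
unique-rotate {x = x} ys zs u with rotated@(_ ∷ u′) ← unique-↭ (rotate↭ x ys zs) u =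
  Uniqueₚ.Unique[x∷xs]⇒x∉xs rotated , u′

splitPath : ∀ {G : Graph} {x : V G} ys {zs} → IsPath G (ys ++ x ∷ zs) →
            (IsPath G ys × x ∉ ys) × (IsPath G zs × x ∉ zs)
splitPath ys {zs} (u , l)
  with uy , (_ ∷ uz) ← unique-++⁻ ys u | ly , lxz ← linked-++⁻ ys l
     | x∉ , _ ← unique-rotate ys zs u
  = ((uy , ly) , x∉ ∘ ∈-++⁺ʳ zs) , (uz , Linked.tail lxz) , x∉ ∘ ∈-++⁺ˡ

openCycle : ∀ {G : Graph} {x : V G} ys {zs} → IsCycle G (ys ++ x ∷ zs) →
            IsPath G (zs ++ ys) × x ∉ zs ++ ys
openCycle ys {zs} ((u , l) , closing)
  with ly , lxz ← linked-++⁻ ys l | x∉ , u′ ← unique-rotate ys zs u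
  = (u′ , Linkedₚ.++⁺ (Linked.tail lxz) (closing-edge ys zs closing) ly) , x∉

linked-tabulate : ∀ {n} (f : Fin n → A) →
                  (∀ i j → toℕ j ≡ suc (toℕ i) → R (f i) (f j)) → Linked R (tabulate f)
linked-tabulate {n = zero}        f adj = []
linked-tabulate {n = suc zero}    f adj = [-]
linked-tabulate {n = suc (suc n)} f adj =
  adj Fin.zero (Fin.suc Fin.zero) refl
    ∷ linked-tabulate (λ i → f (Fin.suc i)) (λ i j e → adj (Fin.suc i) (Fin.suc j) (cong suc e))

last-tabulate : ∀ {n} (f : Fin (suc n) → A) → last (tabulate f) ≡ just (f (fromℕ n))
last-tabulate {n = zero}  f = refl
last-tabulate {n = suc n} f = last-tabulate (λ i → f (Fin.suc i))

pathFromFin : ∀ {G m} → ContainsPath G m → Σ (List (V G)) λ xs → length xs ≡ m × IsPath G xs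
pathFromFin (f , inj , adj) =
  tabulate f , length-tabulate f , Uniqueₚ.tabulate⁺ inj , linked-tabulate f adj

cycleFromFin : ∀ {G m} → ContainsCycle G m → Σ (List (V G)) λ xs → length xs ≡ m × IsCycle G xs
cycleFromFin {m = suc n} (_ , f , inj , adj) =
  tabulate f , length-tabulate f ,
  (Uniqueₚ.tabulate⁺ inj , linked-tabulate f (λ i j e → adj i j (inj₁ e))) ,
  subst (λ l → Connected _ l (just (f Fin.zero))) (sym (last-tabulate f))
        (just (adj (fromℕ n) Fin.zero (inj₂ (toℕ-fromℕ n , refl))))

inCopy : ∀ {h d} → Fin (suc d) → SV h d → SV (suc h) d
inCopy i x = just (i , x)

apex? : ∀ {h d} (v : SV (suc h) d) → Dec (nothing ≡ v)
apex? nothing  = yes refl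
apex? (just _) = no λ ()

-- A chain of adjacent vertices avoiding the apex lies in a single copy,
-- since vertices of different copies are never adjacent.
inOneCopy : ∀ {h d} {xs : List (SV (suc h) d)} → Linked (SAdj (suc h) d) xs → nothing ∉ xs →
            ∃₂ λ i ys → xs ≡ map (inCopy i) ys
inOneCopy {xs = []} _ _ = Fin.zero , [] , refl
inOneCopy {xs = nothing ∷ _} _ apex∉ = ⊥-elim (apex∉ (here refl))
inOneCopy {xs = just (i , y) ∷ []} _ _ = i , y ∷ [] , refl
inOneCopy {xs = just (i , y) ∷ _ ∷ _} (adj ∷ l) apex∉
  with inOneCopy l (λ apex∈ → apex∉ (there apex∈))
... | j , y′ ∷ ys , refl with refl , _ ← adj = i , y ∷ y′ ∷ ys , refl

-- Hence an apex-free path of S(h+1,d) is a path of S(h,d), so it obeys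
-- every bound that paths of S(h,d) obey.
apexFreeBound : ∀ {h d N} → (∀ {ys} → IsPath (S h d) ys → length ys < N) →
                {xs : List (SV (suc h) d)} → IsPath (S (suc h) d) xs → nothing ∉ xs → length xs < N
apexFreeBound bound (u , l) apex∉ with inOneCopy l apex∉
... | i , ys , refl =
  subst (_< _) (sym (length-map (inCopy i) ys))
        (bound (Uniqueₚ.map⁻ u , Linked.map proj₂ (Linkedₚ.map⁻ l)))

pathBound : ∀ {d} h {xs} → IsPath (S h d) xs → length xs < 2 ^ suc h
pathBound zero    (_ , [])    = z<s
pathBound zero    (_ , [-])   = s<s z<s
pathBound zero    (_ , () ∷ _)
pathBound (suc h) {xs} p with any? apex? xs
... | no apex∉ = ≤-trans (apexFreeBound (pathBound h) p apex∉) (m≤m+n _ _)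
... | yes apex∈ with ys , zs , refl ← ∈-∃++ apex∈
                 with (pys , apex∉ys) , (pzs , apex∉zs) ← splitPath ys p =
  lengthBound (+-mono-≤ (apexFreeBound (pathBound h) pys apex∉ys)
                        (apexFreeBound (pathBound h) pzs apex∉zs))
  where
  -- |ys ++ apex ∷ zs| = |ys| + 1 + |zs|, and 2^(h+2) = 2^(h+1) + 2^(h+1).
  lengthBound : suc (length ys + suc (length zs)) ≤ 2 ^ suc h + 2 ^ suc h →
                length (ys ++ nothing ∷ zs) < 2 ^ suc (suc h)
  lengthBound b rewrite length-++ ys {nothing ∷ zs} | +-identityʳ (2 ^ suc h) = b

cycleBound : ∀ {d} h {xs} → IsCycle (S (suc h) d) xs → length xs ≤ 2 ^ suc h
cycleBound h {xs} c with any? apex? xs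
... | no apex∉ = <⇒≤ (apexFreeBound (pathBound h) (proj₁ c) apex∉)
... | yes apex∈ with ys , zs , refl ← ∈-∃++ apex∈
                 with p , apex∉ ← openCycle ys c =
  subst (_≤ _) (sym (↭-length (rotate↭ nothing ys zs))) (apexFreeBound (pathBound h) p apex∉)

mainTheorem15 : (k d : ℕ) → 1 ≤ k → 1 ≤ d →
    ¬ ContainsPath (S k d) (2 ^ (k + 1)) ×
    ((m : ℕ) → 2 ^ k + 1 ≤ m → ¬ ContainsCycle (S k d) m)
mainTheorem15 (suc h) d _ _ = noLongPath , noLongCycle
  where
  noLongPath : ¬ ContainsPath (S (suc h) d) (2 ^ (suc h + 1))
  noLongPath c with xs , len , p ← pathFromFin c =
    <⇒≱ (pathBound (suc h) p) (≤-reflexive (trans (cong (2 ^_) (+-comm 1 (suc h))) (sym len)))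
  noLongCycle : (m : ℕ) → 2 ^ suc h + 1 ≤ m → ¬ ContainsCycle (S (suc h) d) m
  noLongCycle m long c with xs , refl , cyc ← cycleFromFin c =
    <⇒≱ (subst (_≤ length xs) (+-comm (2 ^ suc h) 1) long) (cycleBound h cyc)
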